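{- Let $G$ be a connected graph without isolated vertices. Then \[ \chi_d^t(G)\leq \gamma_t(G)+\min_S \chi(G[V(G)-S]), \] where the minimum is taken over all $\gamma_t(G)$-sets $S\subseteq V(G)$ (i.e., total dominating sets of $G$ of cardinality $\gamma_t(G)$). Moreover, this upper bound is sharp.
   Context: All graphs are finite, simple and undirected. A total dominating set of $G$ is a set $S\subseteq V(G)$ such that every vertex of $G$ has a neighbor in $S$; $\gamma_t(G)$ is the minimum cardinality of a total dominating set. $\chi(H)$ is the chromatic number of $H$, and $G[X]$ is the subgraph induced by $X$. A total dominator coloring of a graph $G$ is a proper vertex coloring of $G$ in which each vertex of $G$ is adjacent to every vertex of some color class (a color class is the set of all vertices receiving a given color). The total dominator chromatic number $\chi_d^t(G)$ is the minimum number of color classes in a total dominator coloring of $G$. -}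

module Defs where

open import Data.Nat using (ℕ; _≤_; _+_)
open import Data.Fin using (Fin)
open import Data.Fin.Subset using (Subset; _∈_; _∉_; ∣_∣)
open import Data.Bool using (Bool; true; false)
open import Data.Product using (Σ; ∃; _×_; _,_)
open import Relation.Binary.PropositionalEquality using (_≡_; _≢_)
open import Relation.Nullary using (¬_)

record Graph (n : ℕ) : Set where
  field
    adj     : Fin n → Fin n → Bool
    adj-sym : ∀ u v → adj u v ≡ adj v u
    adj-irr : ∀ v → adj v v ≡ false

open Graph public

Edge : ∀ {n} → Graph n → Fin n → Fin n → Set
Edge G u v = adj G u v ≡ true

data Reachable {n} (G : Graph n) : Fin n → Fin n → Set where
  here : ∀ {v} → Reachable G v v
  step : ∀ {u w v} → Edge G u w → Reachable G w v → Reachable G u v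

Connected : ∀ {n} → Graph n → Set
Connected G = ∀ u v → Reachable G u v

NoIsolated : ∀ {n} → Graph n → Set
NoIsolated G = ∀ v → ∃ λ u → Edge G v u

IsTDS : ∀ {n} → Graph n → Subset n → Set
IsTDS G S = ∀ v → ∃ λ u → u ∈ S × Edge G v u

IsTotalDomNumber : ∀ {n} → Graph n → ℕ → Set
IsTotalDomNumber G γ =
  (∃ λ S → IsTDS G S × ∣ S ∣ ≡ γ) × (∀ S → IsTDS G S → γ ≤ ∣ S ∣)

IsγtSet : ∀ {n} → Graph n → Subset n → Set
IsγtSet G S = IsTDS G S × (∀ T → IsTDS G T → ∣ S ∣ ≤ ∣ T ∣)

-- proper coloring of the induced subgraph G[V(G) - S] with k colors
-- (colours of vertices in S are irrelevant)
ProperColoringOutside : ∀ {n} → Graph n → Subset n → (k : ℕ) → (Fin n → Fin k) → Set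
ProperColoringOutside G S k c =
  ∀ u v → u ∉ S → v ∉ S → Edge G u v → c u ≢ c v

ColorableOutside : ∀ {n} → Graph n → Subset n → ℕ → Set
ColorableOutside G S k = ∃ λ (c : Fin _ → Fin k) → ProperColoringOutside G S k c

IsChromaticOutside : ∀ {n} → Graph n → Subset n → ℕ → Set
IsChromaticOutside G S k =
  ColorableOutside G S k × (∀ j → ColorableOutside G S j → k ≤ j)

IsMinChromaticOverγtSets : ∀ {n} → Graph n → ℕ → Set
IsMinChromaticOverγtSets G m =
  (∃ λ S → IsγtSet G S × IsChromaticOutside G S m)
  × (∀ S j → IsγtSet G S → IsChromaticOutside G S j → m ≤ j)

-- total dominator coloring with exactly k colour classes:
-- c is proper, surjective (every colour is a nonempty class), and every
-- vertex is adjacent to all vertices of some colour class.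
IsTDColoring : ∀ {n} → Graph n → (k : ℕ) → (Fin n → Fin k) → Set
IsTDColoring G k c =
  (∀ u v → Edge G u v → c u ≢ c v)
  × (∀ i → ∃ λ u → c u ≡ i)
  × (∀ v → ∃ λ i → ∀ u → c u ≡ i → Edge G v u)

HasTDColoring : ∀ {n} → Graph n → ℕ → Set
HasTDColoring G k = ∃ λ (c : Fin _ → Fin k) → IsTDColoring G k c

IsTDChromaticNumber : ∀ {n} → Graph n → ℕ → Set
IsTDChromaticNumber G k = HasTDColoring G k × (∀ j → HasTDColoring G j → k ≤ j)

{-# OPTIONS --safe #-}
module Submission where

-- Color a γt-set S injectively with ∣S∣ colors and G − S with χ(G[V − S]) further colors.
-- Every vertex of S is then a singleton class, so a vertex totally dominated by u ∈ S is adjacent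
-- to the whole class of u; discarding unused colors leaves a total dominator coloring with at most
-- γt + χ colors. Equality holds for the path P₄: its inner vertices form the only γt-set, the
-- leaves are independent, and as sole neighbours of the leaves the inner vertices are singleton
-- classes of every total dominator coloring, so the leaves need a third color.

open import Defs
open import Data.Bool using (Bool; false; _∨_)
open import Data.Bool.Properties using (∨-comm)
open import Data.Fin using (Fin; zero; suc; toℕ; join; splitAt; punchOut)
open import Data.Fin.Patterns using (0F; 1F; 2F; 3F)
open import Data.Fin.Properties
  using (_≟_; all?; any?; ¬∀⟶∃¬; splitAt-join; punchOut-injective; suc-injective; injective⇒≤;
         nonZeroIndex)
open import Data.Fin.Subset using (Subset; _∈_; _∉_; _⊆_; ∣_∣; inside; outside)
open import Data.Fin.Subset.Properties using (_∈?_; p⊆q⇒∣p∣≤∣q∣)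
open import Data.Nat using (ℕ; zero; suc; _≤_; _<_; _+_; _≡ᵇ_; z<s; >-nonZero⁻¹)
open import Data.Nat.Properties using (≤-refl; ≤-trans; ≤-antisym; m≤n⇒m≤1+n; +-monoˡ-≤)
open import Data.Product using (Σ; ∃; _×_; _,_; proj₂)
open import Data.Sum using (_⊎_; inj₁; inj₂)
open import Data.Sum.Properties using (inj₁-injective; inj₂-injective)
open import Data.Vec using ([]; _∷_; here; there)
open import Function using (id; _∘_)
open import Function.Definitions using (Injective)
open import Relation.Binary.PropositionalEquality
  using (_≡_; _≢_; refl; sym; trans; cong; subst; module ≡-Reasoning)
open import Relation.Nullary using (¬_; yes; no; contradiction)

private
  variable
    n k : ℕ
    u v : Fin n
    A B C : Set

IsSingletonClass : (Fin n → A) → Fin n → Set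
IsSingletonClass c u = ∀ x → c x ≡ c u → x ≡ u

Refines : (Fin n → A) → (Fin n → B) → Set
Refines c′ c = ∀ u v → c′ u ≡ c′ v → c u ≡ c v

refines-trans : {c″ : Fin n → A} {c′ : Fin n → B} {c : Fin n → C} →
                Refines c″ c′ → Refines c′ c → Refines c″ c
refines-trans c″⊑c′ c′⊑c u v = c′⊑c u v ∘ c″⊑c′ u v

module _ (G : Graph n) where

  Edge-sym : Edge G u v → Edge G v u
  Edge-sym {u} {v} e = trans (adj-sym G v u) e

  Edge-irrefl : ¬ Edge G v v
  Edge-irrefl {v} e with trans (sym (adj-irr G v)) e
  ... | ()

  Reachable-trans : ∀ {w} → Reachable G u v → Reachable G v w → Reachable G u w
  Reachable-trans here       r′ = r′
  Reachable-trans (step e r) r′ = step e (Reachable-trans r r′)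

  Reachable-sym : Reachable G u v → Reachable G v u
  Reachable-sym here       = here
  Reachable-sym (step e r) = Reachable-trans (Reachable-sym r) (step (Edge-sym e) here)

  ProperColoring : (Fin n → A) → Set
  ProperColoring c = ∀ u v → Edge G u v → c u ≢ c v

  -- The dominated class is named by a member, not a color, so the property survives refinement.
  DominatesSomeClass : (Fin n → A) → Set
  DominatesSomeClass c = ∀ v → ∃ λ u → ∀ x → c x ≡ c u → Edge G v x

  proper-refine : {c′ : Fin n → A} {c : Fin n → B} →
                  Refines c′ c → ProperColoring c → ProperColoring c′
  proper-refine c′⊑c proper u v e = proper u v e ∘ c′⊑c u v

  dominates-refine : {c′ : Fin n → A} {c : Fin n → B} →
                     Refines c′ c → DominatesSomeClass c → DominatesSomeClass c′
  dominates-refine c′⊑c dominates v with dominates v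
  ... | u , dominated = u , λ x → dominated x ∘ c′⊑c x u

  singletons-dominate : ∀ {S} {c : Fin n → A} → IsTDS G S →
                        (∀ {u} → u ∈ S → IsSingletonClass c u) → DominatesSomeClass c
  singletons-dominate tds singleton v with tds v
  ... | u , u∈S , vu = u , λ x cx≡cu → subst (Edge G v) (sym (singleton u∈S x cx≡cu)) vu

recolorAvoiding : (c : Fin n → Fin (suc k)) {i : Fin (suc k)} → (∀ u → i ≢ c u) →
                  Σ (Fin n → Fin k) λ c′ → Refines c′ c
recolorAvoiding c i∉c = (λ u → punchOut (i∉c u)) , λ u v → punchOut-injective (i∉c u) (i∉c v)

dropUnusedColors : ∀ k (c : Fin n → Fin k) →
                   ∃ λ j → j ≤ k × Σ (Fin n → Fin j) λ c′ → (∀ i → ∃ λ u → c′ u ≡ i) × Refines c′ c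
dropUnusedColors zero    c = zero , ≤-refl , c , (λ ()) , λ _ _ → id
dropUnusedColors (suc k) c with all? (λ i → any? λ u → c u ≟ i)
... | yes allUsed = suc k , ≤-refl , c , allUsed , λ _ _ → id
... | no someUnused with ¬∀⟶∃¬ _ _ (λ i → any? λ u → c u ≟ i) someUnused
... | i , unused with recolorAvoiding c (λ u i≡cu → unused (u , sym i≡cu))
... | c₁ , c₁⊑c with dropUnusedColors k c₁
... | j , j≤k , c′ , onto , c′⊑c₁ = j , m≤n⇒m≤1+n j≤k , c′ , onto , refines-trans c′⊑c₁ c₁⊑c

-- Surjectivity is needed because IsTDColoring counts color classes, which must be nonempty.
proper-dominating⇒tdColoring : ∀ (G : Graph n) {c : Fin n → Fin k} →
  ProperColoring G c → DominatesSomeClass G c → ∃ λ j → j ≤ k × HasTDColoring G j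
proper-dominating⇒tdColoring {k = k} G {c} proper dominates with dropUnusedColors k c
... | j , j≤k , c′ , onto , c′⊑c =
  j , j≤k , c′ , proper-refine G c′⊑c proper , onto ,
  λ v → let (u , dominated) = dominates-refine G c′⊑c dominates v in c′ u , dominated

rank : (S : Subset n) → v ∈ S → Fin ∣ S ∣
rank (inside  ∷ S) here      = zero
rank (inside  ∷ S) (there p) = suc (rank S p)
rank (outside ∷ S) (there p) = rank S p

rank-injective : ∀ {S : Subset n} (p : u ∈ S) (q : v ∈ S) → rank S p ≡ rank S q → u ≡ v
rank-injective {S = inside  ∷ S} here      here      _ = refl
rank-injective {S = inside  ∷ S} (there p) (there q) e = cong suc (rank-injective p q (suc-injective e))
rank-injective {S = outside ∷ S} (there p) (there q) e = cong suc (rank-injective p q e)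

join-injective : ∀ m n → Injective _≡_ _≡_ (join m n)
join-injective m n {x} {y} e = begin
  x                      ≡⟨ splitAt-join m n x ⟨
  splitAt m (join m n x) ≡⟨ cong (splitAt m) e ⟩
  splitAt m (join m n y) ≡⟨ splitAt-join m n y ⟩
  y                      ∎
  where open ≡-Reasoning

module _ (S : Subset n) (c₀ : Fin n → Fin k) where

  separateColoring : Fin n → Fin ∣ S ∣ ⊎ Fin k
  separateColoring u with u ∈? S
  ... | yes u∈S = inj₁ (rank S u∈S)
  ... | no  _   = inj₂ (c₀ u)

  member-singleton : u ∈ S → IsSingletonClass separateColoring u
  member-singleton {u} u∈S x with u ∈? S | x ∈? S
  ... | yes p   | yes q = rank-injective q p ∘ inj₁-injective
  ... | yes _   | no  _ = λ ()
  ... | no  u∉S | _     = contradiction u∈S u∉S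

  separateColoring-proper : ∀ G → ProperColoringOutside G S k c₀ → ProperColoring G separateColoring
  separateColoring-proper G c₀-proper u v uv with u ∈? S | v ∈? S
  ... | yes p   | yes q   = λ e →
    Edge-irrefl G (subst (Edge G u) (sym (rank-injective p q (inj₁-injective e))) uv)
  ... | yes _   | no  _   = λ ()
  ... | no  _   | yes _   = λ ()
  ... | no  u∉S | no  v∉S = c₀-proper u v u∉S v∉S uv ∘ inj₂-injective

tdColoringWithin : ∀ (G : Graph n) {S} → IsTDS G S → ColorableOutside G S k →
                   ∃ λ j → j ≤ ∣ S ∣ + k × HasTDColoring G j
tdColoringWithin G {S} tds (c₀ , c₀-proper) =
  proper-dominating⇒tdColoring G
    (proper-refine G joined (separateColoring-proper S c₀ G c₀-proper))
    (dominates-refine G joined (singletons-dominate G tds (member-singleton S c₀)))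
  where
  joined : Refines (join _ _ ∘ separateColoring S c₀) (separateColoring S c₀)
  joined _ _ = join-injective _ _

tdChromatic≤∣S∣+k : ∀ (G : Graph n) {S χ} → IsTDChromaticNumber G χ →
                    IsTDS G S → ColorableOutside G S k → χ ≤ ∣ S ∣ + k
tdChromatic≤∣S∣+k G (_ , χ-minimal) tds colorable with tdColoringWithin G tds colorable
... | j , j≤ , colored = ≤-trans (χ-minimal j colored) j≤

tdChromatic≤γt+minχ : ∀ (G : Graph n) {γ m χdt} → IsTotalDomNumber G γ →
                      IsMinChromaticOverγtSets G m → IsTDChromaticNumber G χdt → χdt ≤ γ + m
tdChromatic≤γt+minχ G {m = m}
  ((T , T-tds , refl) , _) ((S , (S-tds , S-minimum) , S-colorable , _) , _) χdt =
  ≤-trans (tdChromatic≤∣S∣+k G χdt S-tds S-colorable) (+-monoˡ-≤ m (S-minimum T T-tds))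

soleNeighbour∈TDS : ∀ (G : Graph n) {T} → (∀ x → Edge G v x → x ≡ u) → IsTDS G T → u ∈ T
soleNeighbour∈TDS {v = v} G {T} sole tds with tds v
... | w , w∈T , vw = subst (_∈ T) (sole w vw) w∈T

soleNeighbour-singleton : ∀ (G : Graph n) {c : Fin n → Fin k} → IsTDColoring G k c →
                          (∀ x → Edge G v x → x ≡ u) → IsSingletonClass c u
soleNeighbour-singleton {v = v} {u} G {c} (_ , onto , dominates) sole x cx≡cu with dominates v
... | i , dominated with onto i
... | w , cw≡i = sole x (dominated x (begin
  c x ≡⟨ cx≡cu ⟩
  c u ≡⟨ cong c (sym (sole w (dominated w cw≡i))) ⟩
  c w ≡⟨ cw≡i ⟩
  i   ∎))
  where open ≡-Reasoning

distinct₃⇒3≤ : {x y z : Fin k} → x ≢ y → y ≢ z → x ≢ z → 3 ≤ k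
distinct₃⇒3≤ {k = k} {x} {y} {z} x≢y y≢z x≢z = injective⇒≤ f-injective
  where
  f : Fin 3 → Fin k
  f 0F = x
  f 1F = y
  f 2F = z

  f-injective : Injective _≡_ _≡_ f
  f-injective {0F} {0F} _ = refl
  f-injective {1F} {1F} _ = refl
  f-injective {2F} {2F} _ = refl
  f-injective {0F} {1F} e = contradiction e x≢y
  f-injective {1F} {0F} e = contradiction (sym e) x≢y
  f-injective {1F} {2F} e = contradiction e y≢z
  f-injective {2F} {1F} e = contradiction (sym e) y≢z
  f-injective {0F} {2F} e = contradiction e x≢z
  f-injective {2F} {0F} e = contradiction (sym e) x≢z

colors-positive : ∀ {j} → (Fin (suc n) → Fin j) → 0 < j
colors-positive {j = j} c = >-nonZero⁻¹ j {{nonZeroIndex (c 0F)}}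

1+n≡ᵇn : ∀ m → (suc m ≡ᵇ m) ≡ false
1+n≡ᵇn zero    = refl
1+n≡ᵇn (suc m) = 1+n≡ᵇn m

path : ∀ n → Graph n
path n = record
  { adj     = adjacent
  ; adj-sym = λ u v → ∨-comm (next u v) (next v u)
  ; adj-irr = irreflexive
  }
  where
  next : Fin n → Fin n → Bool
  next u v = suc (toℕ u) ≡ᵇ toℕ v

  adjacent : Fin n → Fin n → Bool
  adjacent u v = next u v ∨ next v u

  irreflexive : ∀ v → adjacent v v ≡ false
  irreflexive v rewrite 1+n≡ᵇn (toℕ v) = refl

P₄ : Graph 4
P₄ = path 4

P₄-connected : Connected P₄
P₄-connected u v = Reachable-trans P₄ (to0 u) (Reachable-sym P₄ (to0 v))
  where
  to0 : ∀ u → Reachable P₄ u 0F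
  to0 0F = here
  to0 1F = step refl here
  to0 2F = step {w = 1F} refl (step refl here)
  to0 3F = step {w = 2F} refl (step {w = 1F} refl (step refl here))

P₄-noIsolated : NoIsolated P₄
P₄-noIsolated 0F = 1F , refl
P₄-noIsolated 1F = 0F , refl
P₄-noIsolated 2F = 1F , refl
P₄-noIsolated 3F = 2F , refl

leaf₀ : ∀ x → Edge P₄ 0F x → x ≡ 1F
leaf₀ 1F _ = refl
leaf₀ 0F ()
leaf₀ 2F ()
leaf₀ 3F ()

leaf₃ : ∀ x → Edge P₄ 3F x → x ≡ 2F
leaf₃ 2F _ = refl
leaf₃ 0F ()
leaf₃ 1F ()
leaf₃ 3F ()

inner : Subset 4
inner = outside ∷ inside ∷ inside ∷ outside ∷ []

inner-tds : IsTDS P₄ inner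
inner-tds 0F = 1F , there here , refl
inner-tds 1F = 2F , there (there here) , refl
inner-tds 2F = 1F , there here , refl
inner-tds 3F = 2F , there (there here) , refl

inner⊆TDS : ∀ {T} → IsTDS P₄ T → inner ⊆ T
inner⊆TDS tds (there here)         = soleNeighbour∈TDS P₄ leaf₀ tds
inner⊆TDS tds (there (there here)) = soleNeighbour∈TDS P₄ leaf₃ tds
inner⊆TDS _   (there (there (there (there ()))))

inner-γtSet : IsγtSet P₄ inner
inner-γtSet = inner-tds , λ _ tds → p⊆q⇒∣p∣≤∣q∣ (inner⊆TDS tds)

P₄-γt : IsTotalDomNumber P₄ 2
P₄-γt = (inner , inner-tds , refl) , proj₂ inner-γtSet

outer-independent : ∀ u v → u ∉ inner → v ∉ inner → ¬ Edge P₄ u v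
outer-independent 1F _  1∉ _  _ = 1∉ (there here)
outer-independent 2F _  2∉ _  _ = 2∉ (there (there here))
outer-independent _  1F _  1∉ _ = 1∉ (there here)
outer-independent _  2F _  2∉ _ = 2∉ (there (there here))
outer-independent 0F 0F _  _  ()
outer-independent 0F 3F _  _  ()
outer-independent 3F 0F _  _  ()
outer-independent 3F 3F _  _  ()

outer-1-colorable : ColorableOutside P₄ inner 1
outer-1-colorable = (λ _ → 0F) , λ u v u∉ v∉ uv _ → outer-independent u v u∉ v∉ uv

P₄-minχ : IsMinChromaticOverγtSets P₄ 1
P₄-minχ = (inner , inner-γtSet , outer-1-colorable , λ _ (c , _) → colors-positive c)
        , λ _ _ _ ((c , _) , _) → colors-positive c

P₄-needs-3 : ∀ {j} → HasTDColoring P₄ j → 3 ≤ j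
P₄-needs-3 (c , td@(proper , _)) =
  distinct₃⇒3≤ (proper 0F 1F refl) (proper 1F 2F refl)
    (λ c0≡c2 → contradiction (soleNeighbour-singleton P₄ td leaf₃ 0F c0≡c2) λ ())

P₄-χdt : IsTDChromaticNumber P₄ 3
P₄-χdt with tdColoringWithin P₄ inner-tds outer-1-colorable
... | k , k≤3 , colored =
  subst (HasTDColoring P₄) (≤-antisym k≤3 (P₄-needs-3 colored)) colored , λ _ → P₄-needs-3

theorem3p6 :
    (∀ (n : ℕ) (G : Graph n) (γ m χdt : ℕ)
      → Connected G → NoIsolated G
      → IsTotalDomNumber G γ
      → IsMinChromaticOverγtSets G m
      → IsTDChromaticNumber G χdt
      → χdt ≤ γ + m)
    × (∃ λ (n : ℕ) → Σ (Graph n) λ G → ∃ λ γ → ∃ λ m → ∃ λ χdt →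
        0 < n × Connected G × NoIsolated G × IsTotalDomNumber G γ
        × IsMinChromaticOverγtSets G m × IsTDChromaticNumber G χdt
        × χdt ≡ γ + m)
theorem3p6 = (λ _ G _ _ _ _ _ → tdChromatic≤γt+minχ G)
           , 4 , P₄ , 2 , 1 , 3 , z<s , P₄-connected , P₄-noIsolated , P₄-γt , P₄-minχ , P₄-χdt , refl
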